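{- Let $G=(V,E)$ be a graph. Then $M_{v,w}=W_{v,w}$ for all $v,w\in V$ with $v\neq w$.
   Context: A module of $G$ is a non-empty $M\subseteq V$ such that for all $u\in V\setminus M$ and $x,x'\in M$: $\{u,x\}\in E\iff\{u,x'\}\in E$. $M_{v,w}$ is the intersection of all modules of $G$ containing $v$ and $w$. Two edges $e,e'$ of a graph form a wedge if there are three distinct vertices $u,x,y$ with $e=\{u,x\}$, $e'=\{u,y\}$ and $\{x,y\}$ not an edge; the edge classes of a graph are the equivalence classes of the reflexive transitive closure of the wedge relation on its edge set. The wedge class of $\{v,w\}$ ($v\ne w$) is the edge class of $G$ containing $\{v,w\}$ if $\{v,w\}\in E$, and otherwise the edge class of the complement graph $\overline G$ containing $\{v,w\}$. $W_{v,w}$ is the union of all 2-element sets in the wedge class of $\{v,w\}$. -}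

module Defs where

open import Data.Nat using (ℕ)
open import Data.Fin using (Fin)
open import Data.Fin.Subset using (Subset; _∈_; _∉_)
open import Data.Bool using (Bool; true; false; not; if_then_else_)
open import Data.Product using (_×_; _,_; ∃; ∃-syntax)
open import Data.Sum using (_⊎_)
open import Relation.Binary.PropositionalEquality using (_≡_; _≢_)
open import Relation.Binary.Construct.Closure.ReflexiveTransitive using (Star)

record Graph (n : ℕ) : Set where
  field
    adj    : Fin n → Fin n → Bool
    adj-sym : ∀ x y → adj x y ≡ adj y x
    adj-irr : ∀ x → adj x x ≡ false
open Graph public

IsModule : ∀ {n} → Graph n → Subset n → Set
IsModule {n} G M =
  (∃[ x ] x ∈ M) ×
  (∀ (u x x' : Fin n) → u ∉ M → x ∈ M → x' ∈ M → adj G u x ≡ adj G u x')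

InM : ∀ {n} → Graph n → Fin n → Fin n → Fin n → Set
InM {n} G v w x = ∀ (M : Subset n) → IsModule G M → v ∈ M → w ∈ M → x ∈ M

-- Ordered pairs of vertices; an unordered 2-set {a,b} is represented by
-- (a , b) and (b , a) is identified with it via the 'swap' step below.
Pair : ℕ → Set
Pair n = Fin n × Fin n

data Wedge {n} (R : Fin n → Fin n → Bool) : Pair n → Pair n → Set where
  wedge : ∀ {u x y} → u ≢ x → u ≢ y → x ≢ y →
          R u x ≡ true → R u y ≡ true → R x y ≡ false →
          Wedge R (u , x) (u , y)

data Step {n} (R : Fin n → Fin n → Bool) : Pair n → Pair n → Set where
  step-wedge : ∀ {p q} → Wedge R p q → Step R p q
  step-swap  : ∀ {a b} → Step R (a , b) (b , a)

-- Adjacency of the complement graph (on distinct vertices).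
coadj : ∀ {n} → Graph n → Fin n → Fin n → Bool
coadj G x y = not (adj G x y)

classAdj : ∀ {n} → Graph n → Fin n → Fin n → (Fin n → Fin n → Bool)
classAdj G v w = if adj G v w then adj G else coadj G

InWedgeClass : ∀ {n} → Graph n → Fin n → Fin n → Fin n → Fin n → Set
InWedgeClass G v w a b = Star (Step (classAdj G v w)) (v , w) (a , b)

InW : ∀ {n} → Graph n → Fin n → Fin n → Fin n → Set
InW {n} G v w x = ∃[ a ] ∃[ b ] (InWedgeClass G v w a b × (x ≡ a ⊎ x ≡ b))

-- A module containing v and w is closed under wedge steps: if {c,x} ⊆ M and
-- {c,y}, {x,y} disagree on y, then y cannot lie outside M.  Hence W ⊆ M.
-- Conversely, every vertex u either lies in W or sees all of W as it sees v:
-- along the wedge class u sees both ends of every 2-set alike (otherwise a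
-- wedge to {a,u} puts u into W).  So closing {v,w} under splitting vertices
-- stays inside W and ends in a module, which gives M ⊆ W.
module Submission where

open import Defs
open import Data.Nat using (ℕ; _∸_; _<_)
open import Data.Nat.Induction using (<-wellFounded)
open import Data.Nat.Properties using (∸-monoʳ-<)
open import Data.Fin using (Fin)
open import Data.Fin.Properties using (any?) renaming (_≟_ to _≟ᶠ_)
open import Data.Fin.Subset using (Subset; _∈_; _∉_; _∪_; ⁅_⁆; ∣_∣)
open import Data.Fin.Subset.Properties
  using (_∈?_; x∈⁅x⁆; x∈⁅y⁆⇒x≡y; x∈p∪q⁻; p⊆p∪q; q⊆p∪q; ∣p∣≤n; p⊂q⇒∣p∣<∣q∣)
open import Data.Bool using (Bool; true; false; not)
open import Data.Bool.Properties using (not-injective) renaming (_≟_ to _≟ᵇ_)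
open import Data.Product using (_×_; _,_; ∃-syntax; proj₁; proj₂)
open import Data.Sum using (_⊎_; inj₁; inj₂)
open import Data.Empty using (⊥-elim)
open import Induction.WellFounded using (Acc; acc)
open import Relation.Nullary using (Dec; yes; no; ¬?)
open import Relation.Nullary.Decidable using (_×-dec_)
open import Relation.Binary.PropositionalEquality
  using (_≡_; _≢_; refl; sym; trans; cong; subst; ≢-sym; module ≡-Reasoning)
open import Relation.Binary.Construct.Closure.ReflexiveTransitive
  using (Star; ε; _◅_; _◅◅_)

Star-invariant : ∀ {A : Set} {T : A → A → Set} {s : A} (P : A → Set) → P s →
  (∀ {p q} → Star T s p → T p q → P p → P q) → ∀ {q} → Star T s q → P q
Star-invariant {T = T} {s} P Ps step = go ε Ps
  where
  go : ∀ {p q} → Star T s p → P p → Star T p q → P q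
  go r Pp ε        = Pp
  go r Pp (t ◅ ts) = go (r ◅◅ (t ◅ ε)) (step r t Pp) ts

module Saturation {n : ℕ} (P Q : Subset n → Set)
  (extend : ∀ {S} → P S → Q S ⊎ ∃[ u ] (u ∉ S × P (S ∪ ⁅ u ⁆))) where

  private
    ∣∪⁅⁆∣-shrinks-complement : ∀ {S u} → u ∉ S → n ∸ ∣ S ∪ ⁅ u ⁆ ∣ < n ∸ ∣ S ∣
    ∣∪⁅⁆∣-shrinks-complement {S} {u} u∉S = ∸-monoʳ-<
      (p⊂q⇒∣p∣<∣q∣ (p⊆p∪q ⁅ u ⁆ , u , q⊆p∪q S ⁅ u ⁆ (x∈⁅x⁆ u) , u∉S))
      (∣p∣≤n (S ∪ ⁅ u ⁆))

    go : ∀ {S} → Acc _<_ (n ∸ ∣ S ∣) → P S → ∃[ S′ ] (P S′ × Q S′)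
    go {S} (acc rs) PS with extend PS
    ... | inj₁ QS = S , PS , QS
    ... | inj₂ (u , u∉S , PS∪u) = go (rs (∣∪⁅⁆∣-shrinks-complement u∉S)) PS∪u

  saturate : ∀ {S} → P S → ∃[ S′ ] (P S′ × Q S′)
  saturate = go (<-wellFounded _)

module _ {n : ℕ} (G : Graph n) where

  Homogeneous : Subset n → Set
  Homogeneous S = ∀ u x x′ → u ∉ S → x ∈ S → x′ ∈ S → adj G u x ≡ adj G u x′

  Splitter : Subset n → Set
  Splitter S = ∃[ u ] ∃[ x ] ∃[ x′ ]
    (u ∉ S × x ∈ S × x′ ∈ S × adj G u x ≢ adj G u x′)

  splitter? : ∀ S → Dec (Splitter S)
  splitter? S = any? λ u → any? λ x → any? λ x′ →
    ¬? (u ∈? S) ×-dec (x ∈? S) ×-dec (x′ ∈? S) ×-dec ¬? (adj G u x ≟ᵇ adj G u x′)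

  homogeneous-or-splitter : ∀ S → Homogeneous S ⊎ Splitter S
  homogeneous-or-splitter S with splitter? S
  ... | yes split = inj₂ split
  ... | no ¬split = inj₁ homogeneous
    where
    homogeneous : Homogeneous S
    homogeneous u x x′ u∉S x∈S x′∈S with adj G u x ≟ᵇ adj G u x′
    ... | yes eq = eq
    ... | no neq = ⊥-elim (¬split (u , x , x′ , u∉S , x∈S , x′∈S , neq))

  module _ (v w : Fin n) where

    private
      R : Fin n → Fin n → Bool
      R = classAdj G v w

    classAdj-sym : ∀ a b → R a b ≡ R b a
    classAdj-sym a b with adj G v w
    ... | true  = adj-sym G a b
    ... | false = cong not (adj-sym G a b)

    classAdj-≡⇒adj-≡ : ∀ u a b → R u a ≡ R u b → adj G u a ≡ adj G u b
    classAdj-≡⇒adj-≡ u a b with adj G v w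
    ... | true  = λ eq → eq
    ... | false = not-injective

    adj-≡⇒classAdj-≡ : ∀ u a b → adj G u a ≡ adj G u b → R u a ≡ R u b
    adj-≡⇒classAdj-≡ u a b with adj G v w
    ... | true  = λ eq → eq
    ... | false = cong not

    classAdj-base : R v w ≡ true
    classAdj-base with adj G v w in eq
    ... | true  = eq
    ... | false = cong not eq

    wedgeClass-swap : ∀ {a b} → InWedgeClass G v w a b → InWedgeClass G v w b a
    wedgeClass-swap r = r ◅◅ (step-swap ◅ ε)

    module _ (M : Subset n) (isModule : IsModule G M) where

      wedge-closed : ∀ {c x y} → Wedge R (c , x) (c , y) → c ∈ M → x ∈ M → y ∈ M
      wedge-closed {c} {x} {y} (wedge _ _ _ _ Rcy Rxy) c∈M x∈M with y ∈? M
      ... | yes y∈M = y∈M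
      ... | no  y∉M = ⊥-elim (true≢false (begin
        true   ≡⟨ sym Rcy ⟩
        R c y  ≡⟨ classAdj-sym c y ⟩
        R y c  ≡⟨ adj-≡⇒classAdj-≡ y c x (proj₂ isModule y c x y∉M c∈M x∈M) ⟩
        R y x  ≡⟨ classAdj-sym y x ⟩
        R x y  ≡⟨ Rxy ⟩
        false  ∎))
        where
        open ≡-Reasoning
        true≢false : true ≢ false
        true≢false ()

      BothIn : Pair n → Set
      BothIn (a , b) = a ∈ M × b ∈ M

      wedgeClass⊆module : v ∈ M → w ∈ M → ∀ {a b} → InWedgeClass G v w a b → BothIn (a , b)
      wedgeClass⊆module v∈M w∈M = Star-invariant BothIn (v∈M , w∈M) (λ _ → step)
        where
        step : ∀ {p q} → Step R p q → BothIn p → BothIn q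
        step (step-wedge wdg@(wedge _ _ _ _ _ _)) (c∈M , x∈M) = c∈M , wedge-closed wdg c∈M x∈M
        step step-swap                          (a∈M , b∈M) = b∈M , a∈M

    W⊆M : ∀ x → InW G v w x → InM G v w x
    W⊆M x (a , b , r , x≡a⊎x≡b) M isModule v∈M w∈M with x≡a⊎x≡b
    ... | inj₁ refl = proj₁ (wedgeClass⊆module M isModule v∈M w∈M r)
    ... | inj₂ refl = proj₂ (wedgeClass⊆module M isModule v∈M w∈M r)

    Edge : Pair n → Set
    Edge (a , b) = a ≢ b × R a b ≡ true

    module _ (v≢w : v ≢ w) where

      private
        InW′ : Fin n → Set
        InW′ = InW G v w

      wedgeClass-edge : ∀ {a b} → InWedgeClass G v w a b → Edge (a , b)
      wedgeClass-edge = Star-invariant Edge (v≢w , classAdj-base) (λ _ → step)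
        where
        step : ∀ {p q} → Step R p q → Edge p → Edge q
        step (step-wedge (wedge _ c≢y _ _ Rcy _)) _ = c≢y , Rcy
        step {a , b} step-swap (a≢b , Rab) = ≢-sym a≢b , trans (classAdj-sym b a) Rab

      separator∈W : ∀ {a b} → InWedgeClass G v w a b →
        ∀ u → R u a ≡ true → R u b ≡ false → InW′ u
      separator∈W {a} {b} r u Rua Rub with u ≟ᶠ a | u ≟ᶠ b | wedgeClass-edge r
      ... | yes u≡a | _       | _         = a , b , r , inj₁ u≡a
      ... | no _    | yes u≡b | _         = a , b , r , inj₂ u≡b
      ... | no u≢a  | no u≢b  | a≢b , Rab = a , u , r ◅◅ (step-wedge wdg ◅ ε) , inj₂ refl
        where
        wdg : Wedge R (a , b) (a , u)
        wdg = wedge a≢b (≢-sym u≢a) (≢-sym u≢b) Rab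
          (trans (classAdj-sym a u) Rua) (trans (classAdj-sym b u) Rub)

      wedgeClass-uniform : ∀ {a b} → InWedgeClass G v w a b → ∀ u → R u a ≡ R u b ⊎ InW′ u
      wedgeClass-uniform {a} {b} r u with R u a in Rua | R u b in Rub
      ... | true  | true  = inj₁ refl
      ... | false | false = inj₁ refl
      ... | true  | false = inj₂ (separator∈W r u Rua Rub)
      ... | false | true  = inj₂ (separator∈W (wedgeClass-swap r) u Rub Rua)

      module _ (u : Fin n) where

        SeesLikeV : Pair n → Set
        SeesLikeV (a , _) = R u a ≡ R u v ⊎ InW′ u

        wedgeClass-sees-like-v : ∀ {a b} → InWedgeClass G v w a b → SeesLikeV (a , b)
        wedgeClass-sees-like-v = Star-invariant SeesLikeV (inj₁ refl) step
          where
          step : ∀ {p q} → Star (Step R) (v , w) p → Step R p q → SeesLikeV p → SeesLikeV q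
          step _ (step-wedge (wedge _ _ _ _ _ _)) seen = seen
          step _ step-swap (inj₂ u∈W) = inj₂ u∈W
          step r step-swap (inj₁ Rua≡Ruv) with wedgeClass-uniform r u
          ... | inj₁ Rua≡Rub = inj₁ (trans (sym Rua≡Rub) Rua≡Ruv)
          ... | inj₂ u∈W     = inj₂ u∈W

        W-sees-like-v : ∀ {x} → InW′ x → R u x ≡ R u v ⊎ InW′ u
        W-sees-like-v (a , b , r , inj₁ refl) = wedgeClass-sees-like-v r
        W-sees-like-v (a , b , r , inj₂ refl) = wedgeClass-sees-like-v (wedgeClass-swap r)

        splitter-of-W∈W : ∀ {x x′} → InW′ x → InW′ x′ → adj G u x ≢ adj G u x′ → InW′ u
        splitter-of-W∈W {x} {x′} x∈W x′∈W neq with W-sees-like-v x∈W | W-sees-like-v x′∈W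
        ... | inj₂ u∈W | _        = u∈W
        ... | inj₁ _   | inj₂ u∈W = u∈W
        ... | inj₁ Rux | inj₁ Rux′ = ⊥-elim (neq (classAdj-≡⇒adj-≡ u x x′ (trans Rux (sym Rux′))))

      vw⊆_⊆W : Subset n → Set
      vw⊆ S ⊆W = (∀ y → y ∈ S → InW′ y) × v ∈ S × w ∈ S

      add-splitter : ∀ {S} → vw⊆ S ⊆W → Homogeneous S ⊎ ∃[ u ] (u ∉ S × vw⊆ S ∪ ⁅ u ⁆ ⊆W)
      add-splitter {S} (S⊆W , v∈S , w∈S) with homogeneous-or-splitter S
      ... | inj₁ hom = inj₁ hom
      ... | inj₂ (u , x , x′ , u∉S , x∈S , x′∈S , neq) =
        inj₂ (u , u∉S , S∪u⊆W , p⊆p∪q ⁅ u ⁆ v∈S , p⊆p∪q ⁅ u ⁆ w∈S)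
        where
        S∪u⊆W : ∀ y → y ∈ S ∪ ⁅ u ⁆ → InW′ y
        S∪u⊆W y y∈S∪u with x∈p∪q⁻ S ⁅ u ⁆ y∈S∪u
        ... | inj₁ y∈S = S⊆W y y∈S
        ... | inj₂ y∈u = subst InW′ (sym (x∈⁅y⁆⇒x≡y u y∈u))
                           (splitter-of-W∈W u (S⊆W x x∈S) (S⊆W x′ x′∈S) neq)

      vw⊆pair⊆W : vw⊆ ⁅ v ⁆ ∪ ⁅ w ⁆ ⊆W
      vw⊆pair⊆W = pair⊆W , p⊆p∪q ⁅ w ⁆ (x∈⁅x⁆ v) , q⊆p∪q ⁅ v ⁆ ⁅ w ⁆ (x∈⁅x⁆ w)
        where
        pair⊆W : ∀ y → y ∈ ⁅ v ⁆ ∪ ⁅ w ⁆ → InW′ y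
        pair⊆W y y∈vw with x∈p∪q⁻ ⁅ v ⁆ ⁅ w ⁆ y∈vw
        ... | inj₁ y∈v = v , w , ε , inj₁ (x∈⁅y⁆⇒x≡y v y∈v)
        ... | inj₂ y∈w = v , w , ε , inj₂ (x∈⁅y⁆⇒x≡y w y∈w)

      M⊆W : ∀ x → InM G v w x → InW′ x
      M⊆W x x∈M with Saturation.saturate vw⊆_⊆W Homogeneous add-splitter vw⊆pair⊆W
      ... | S , (S⊆W , v∈S , w∈S) , hom = S⊆W x (x∈M S ((v , v∈S) , hom) v∈S w∈S)

corollary3p7 : ∀ (n : ℕ) (G : Graph n) (v w : Fin n) → v ≢ w →
    ∀ (x : Fin n) → (InM G v w x → InW G v w x) × (InW G v w x → InM G v w x)
corollary3p7 n G v w v≢w x = M⊆W G v w v≢w x , W⊆M G v w x
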